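{- Let $n\ge2$ (and $n\ge3$ for the second identity), $q\in[0,1]$, and let $(X_t)_{t\ge0}$ be the top-or-bottom-to-random shuffle with parameter $q$ of a deck of $n$ distinct cards labelled $1,\dots,n$, started from the ascending deck $X_0=(1,2,\dots,n)$ (card $1$ on top). Then for all $t\ge0$, \[\mathbb{E}\Bigl[\sum_{i\in\mathrm{Des}(X_t)}\binom{n-2}{i-1}q^{i-1}(1-q)^{n-1-i}\Bigr]=\Bigl(1-\Bigl(\frac{n-2}{n}\Bigr)^{t}\Bigr)\frac12,\] \[\mathbb{E}\Bigl[\sum_{i\in\mathrm{Peak}(X_t)}\binom{n-3}{i-1}q^{i-1}(1-q)^{n-2-i}\Bigr]=\Bigl(1-\Bigl(\frac{n-3}{n}\Bigr)^{t}\Bigr)\frac13.\]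
   Context: A deck is a sequence $X=(x_1,\dots,x_n)$ of the distinct cards $1,\dots,n$, with $x_1$ the top card and $x_n$ the bottom card. The top-or-bottom-to-random shuffle with parameter $q$: at each step, independently, with probability $q$ remove the top card and reinsert it into one of the $n$ possible positions in the deck chosen uniformly at random, and with probability $1-q$ remove the bottom card and reinsert it into one of the $n$ possible positions chosen uniformly at random. The descent set is $\mathrm{Des}(X)=\{i\in\{1,\dots,n-1\}:x_i>x_{i+1}\}$ and the peak set is $\mathrm{Peak}(X)=\{i\in\{1,\dots,n-2\}:x_i<x_{i+1}>x_{i+2}\}$. The convention $0^0=1$ is used.
   Formalization: The parameter q ranges over the rational numbers in $[0,1]$. -}

module Defs where

open import Data.Nat using (ℕ; zero; suc; _∸_; _<ᵇ_)
open import Data.Nat.Combinatorics using (_C_)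
open import Data.Bool using (Bool; true; false; if_then_else_; _∧_)
open import Data.List using (List; []; _∷_; map; filter; upTo; concatMap; foldr; _++_)
open import Data.Product using (_×_; _,_)
open import Data.Integer using (+_)
open import Data.Rational using (ℚ; 0ℚ; 1ℚ; _+_; _*_; _-_; _/_)
open import Relation.Nullary.Decidable using (T?)

-- Rational powers with natural exponents (so 0 ^ 0 = 1).
_^_ : ℚ → ℕ → ℚ
x ^ zero  = 1ℚ
x ^ suc k = x * (x ^ k)

ℕ→ℚ : ℕ → ℚ
ℕ→ℚ k = + k / 1

-- 1/n for n ≥ 1 (value at 0 is irrelevant: only used with n ≥ 2)
inv : ℕ → ℚ
inv zero    = 0ℚ
inv (suc k) = + 1 / suc k

sumℚ : List ℚ → ℚ
sumℚ = foldr _+_ 0ℚ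

-- A deck: list of cards, head = top card.
Deck : Set
Deck = List ℕ

-- x_i with 1-based index i (default 0 out of range; never used out of range)
card : Deck → ℕ → ℕ
card []       _             = 0
card (x ∷ xs) zero          = 0
card (x ∷ xs) (suc zero)    = x
card (x ∷ xs) (suc (suc i)) = card xs (suc i)

-- insert a card at position j (0 = top, ..., length = bottom)
insertAt : ℕ → ℕ → Deck → Deck
insertAt j       c []       = c ∷ []
insertAt zero    c xs       = c ∷ xs
insertAt (suc j) c (x ∷ xs) = x ∷ insertAt j c xs

removeBottom : Deck → Deck × ℕ
removeBottom []           = [] , 0
removeBottom (x ∷ [])     = [] , x
removeBottom (x ∷ y ∷ xs) with removeBottom (y ∷ xs)
... | rest , b = (x ∷ rest) , b

positions : ℕ → List ℕ
positions n = upTo n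

-- A finitely supported (sub)distribution as a weighted list of decks
-- (weights add; the same deck may appear several times).
Dist : Set
Dist = List (ℚ × Deck)

stepDeck : ℕ → ℚ → Deck → List (ℚ × Deck)
stepDeck n q []       = []
stepDeck n q (x ∷ xs) =
  map (λ j → (q * inv n) , insertAt j x xs) (positions n)
  ++ (let rb = removeBottom (x ∷ xs) in
      map (λ j → ((1ℚ - q) * inv n) , insertAt j (Data.Product.proj₂ rb) (Data.Product.proj₁ rb))
          (positions n))

step : ℕ → ℚ → Dist → Dist
step n q = concatMap (λ { (w , d) → map (λ { (p , d′) → (w * p) , d′ }) (stepDeck n q d) })

ascending : ℕ → Deck
ascending n = map suc (upTo n)

law : ℕ → ℚ → ℕ → Dist
law n q zero    = (1ℚ , ascending n) ∷ []
law n q (suc t) = step n q (law n q t)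

𝔼 : Dist → (Deck → ℚ) → ℚ
𝔼 μ f = sumℚ (map (λ { (w , d) → w * f d }) μ)

from1 : ℕ → List ℕ
from1 k = map suc (upTo k)

Des : ℕ → Deck → List ℕ
Des n X = filter (λ i → T? (card X (suc i) <ᵇ card X i)) (from1 (n ∸ 1))

Peak : ℕ → Deck → List ℕ
Peak n X = filter (λ i → T? ((card X i <ᵇ card X (suc i)) ∧ (card X (suc (suc i)) <ᵇ card X (suc i))))
                  (from1 (n ∸ 2))

desStat : ℕ → ℚ → Deck → ℚ
desStat n q X = sumℚ (map (λ i → ℕ→ℚ ((n ∸ 2) C (i ∸ 1)) * (q ^ (i ∸ 1)) * ((1ℚ - q) ^ (n ∸ 1 ∸ i))) (Des n X))

peakStat : ℕ → ℚ → Deck → ℚ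
peakStat n q X = sumℚ (map (λ i → ℕ→ℚ ((n ∸ 3) C (i ∸ 1)) * (q ^ (i ∸ 1)) * ((1ℚ - q) ^ (n ∸ 2 ∸ i))) (Peak n X))

half third : ℚ
half  = + 1 / 2
third = + 1 / 3

module Submission where

-- Fix a pattern P on windows of s + 1 consecutive cards and put n = s + 1 + m.  The statistic
-- S(X) = Σ_{k ≤ m} C(m,k) q^k (1-q)^(m-k) [P holds at positions k+1, …, k+s+1 of X] is the descent
-- statistic for s = 1 and the peak statistic for s = 2; in both cases P says that the largest card of the
-- window sits at a fixed place.  Reinsert a card c into a deck Y of the other n - 1 cards at each of the n
-- positions: the k insertions to the left of the window shift it (P as in Y at k), the m - k to the right
-- leave it alone (P as in Y at k + 1), and exactly one of the s + 1 insertions inside it puts the largest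
-- card in the distinguished place.  Averaging the top and the bottom move with weights q and 1 - q, the
-- absorption identity q C(m,k) (m-k) = (1-q) C(m,k+1) (k+1) makes the shifted terms recombine, so
-- E[S(X_{t+1}) | X_t] = (m S(X_t) + 1) / n.  As S vanishes on the ascending deck, the affine recurrence
-- solves to E[S(X_t)] = (1 - (m/n)^t) / (s + 1).

open import Defs
open import Algebra.Bundles using (CommutativeRing)
open import Data.Bool using (Bool; true; false; T; _∧_)
open import Data.Bool.Properties using (T-≡; ∧-zeroʳ)
open import Data.Fin using (toℕ)
open import Data.Fin.Properties using (toℕ<n; toℕ-inject₁; toℕ-fromℕ)
import Data.Integer as ℤ
open import Data.Integer.Properties as ℤₚ using (pos-*)
open import Data.List using (List; []; _∷_; _++_; _∷ʳ_; length; take; drop; map; filter; upTo; applyUpTo)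
open import Data.List.Properties using (length-map; length-upTo; map-∘)
open import Data.List.Relation.Binary.Permutation.Propositional
  using (_↭_; ↭-refl; ↭-sym; ↭-trans; ↭-prep; ↭-swap; ↭-reflexive; ↭⇒↭ₛ)
open import Data.List.Relation.Binary.Permutation.Propositional.Properties using (↭-length; ∷↭∷ʳ)
open import Data.List.Relation.Unary.All as All using (All; []; _∷_)
import Data.List.Relation.Unary.All.Properties as Allₚ
open import Data.List.Relation.Unary.AllPairs as AllPairs using (AllPairs; []; _∷_)
import Data.List.Relation.Unary.AllPairs.Properties as AllPairsₚ
open import Data.List.Relation.Unary.Unique.Propositional using (Unique)
import Data.List.Relation.Unary.Unique.Propositional.Properties as Uniqueₚ
import Data.Nat as ℕ
open import Data.Nat using (ℕ; zero; suc; pred; _∸_; _<_; _≤_; s≤s; z<s; s<s; _<ᵇ_)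
open import Data.Nat.Combinatorics using (_C_; nC1≡n; nCk+nC[k+1]≡[n+1]C[k+1]; k>n⇒nCk≡0)
import Data.Nat.Coprimality as Coprimality
open import Data.Nat.Properties as ℕₚ using ()
open import Data.Product using (_×_; _,_; proj₁; proj₂)
open import Data.Rational using (ℚ; mkℚ; 0ℚ; 1ℚ; _+_; _*_; _-_) renaming (_≤_ to _≤ℚ_)
open import Data.Rational.Properties
  using (+-*-commutativeRing; normalize-coprime; /-cong; *-inverseˡ; *-zeroˡ; *-zeroʳ; *-identityˡ; *-identityʳ;
         *-distribʳ-+; *-assoc; +-identityˡ; +-assoc)
open import Data.Rational.Solver using (module +-*-Solver)
open import Function using (_∘_; id)
open import Function.Bundles using (Equivalence)
open import Relation.Binary.Definitions using (tri<; tri≈; tri>)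
open import Relation.Binary.PropositionalEquality renaming (setoid to ≡-setoid)
open import Relation.Nullary using (yes; no; contradiction)
open import Relation.Nullary.Decidable using (T?)

open import Data.List.Relation.Binary.Permutation.Setoid.Properties (≡-setoid ℕ) using (Unique-resp-↭)

open +-*-Solver
open ≡-Reasoning

private
  ℚ-semiring = CommutativeRing.semiring +-*-commutativeRing

open import Algebra.Properties.Semiring.Sum ℚ-semiring
  using (sum; sum-cong-≗; sum-replicate; sum-replicate-zero; sum-init-last; ∑-distrib-+; ∑-comm; *-distribˡ-sum)
open import Algebra.Properties.Semiring.Mult ℚ-semiring using () renaming (_×_ to _·_)
import Algebra.Properties.Semiring.Exp ℚ-semiring as Exp
open import Algebra.Properties.CommutativeSemiring.Binomial (CommutativeRing.commutativeSemiring +-*-commutativeRing)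
  using (theorem; binomialExpansion)

ℕ→ℚ≡mkℚ : ∀ k → ℕ→ℚ k ≡ mkℚ (ℤ.+ k) 0 (Coprimality.sym (Coprimality.1-coprimeTo k))
ℕ→ℚ≡mkℚ k = normalize-coprime _

ℕ→ℚ-+ : ∀ a b → ℕ→ℚ (a ℕ.+ b) ≡ ℕ→ℚ a + ℕ→ℚ b
ℕ→ℚ-+ a b = trans (/-cong numerators refl) (sym (cong₂ _+_ (ℕ→ℚ≡mkℚ a) (ℕ→ℚ≡mkℚ b)))
  where
  numerators : ℤ.+ (a ℕ.+ b) ≡ ℤ.+ a ℤ.* ℤ.+ 1 ℤ.+ ℤ.+ b ℤ.* ℤ.+ 1
  numerators rewrite ℤₚ.*-identityʳ (ℤ.+ a) | ℤₚ.*-identityʳ (ℤ.+ b) = refl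

ℕ→ℚ-* : ∀ a b → ℕ→ℚ (a ℕ.* b) ≡ ℕ→ℚ a * ℕ→ℚ b
ℕ→ℚ-* a b = trans (/-cong (pos-* a b) refl) (sym (cong₂ _*_ (ℕ→ℚ≡mkℚ a) (ℕ→ℚ≡mkℚ b)))

inv-inverseˡ : ∀ n → inv (suc n) * ℕ→ℚ (suc n) ≡ 1ℚ
inv-inverseˡ n = trans (cong₂ _*_ (normalize-coprime (Coprimality.1-coprimeTo (suc n))) (ℕ→ℚ≡mkℚ (suc n)))
                       (*-inverseˡ (mkℚ (ℤ.+ suc n) 0 (Coprimality.sym (Coprimality.1-coprimeTo (suc n)))))

·≡ℕ→ℚ* : ∀ n x → n · x ≡ ℕ→ℚ n * x
·≡ℕ→ℚ* zero    x = sym (*-zeroˡ x)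
·≡ℕ→ℚ* (suc n) x = begin
  x + n · x               ≡⟨ cong₂ _+_ (sym (*-identityˡ x)) (·≡ℕ→ℚ* n x) ⟩
  1ℚ * x + ℕ→ℚ n * x      ≡⟨ sym (*-distribʳ-+ x 1ℚ (ℕ→ℚ n)) ⟩
  (1ℚ + ℕ→ℚ n) * x        ≡⟨ cong (_* x) (sym (ℕ→ℚ-+ 1 n)) ⟩
  ℕ→ℚ (suc n) * x         ∎

^≡Exp^ : ∀ x k → x ^ k ≡ x Exp.^ k
^≡Exp^ x zero    = refl
^≡Exp^ x (suc k) = cong (x *_) (^≡Exp^ x k)

1^k≡1 : ∀ k → 1ℚ ^ k ≡ 1ℚ
1^k≡1 zero    = refl
1^k≡1 (suc k) = cong (1ℚ *_) (1^k≡1 k)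

scale-cong : ∀ j {a b : ℚ} → (0 < j → a ≡ b) → ℕ→ℚ j * a ≡ ℕ→ℚ j * b
scale-cong zero {a} {b} _ = trans (*-zeroˡ a) (sym (*-zeroˡ b))
scale-cong (suc j) h = cong (ℕ→ℚ (suc j) *_) (h z<s)

affine-recurrence : ∀ {ρ β c} (E : ℕ → ℚ) → (1ℚ - ρ) * c ≡ β → E 0 ≡ 0ℚ →
  (∀ t → E (suc t) ≡ ρ * E t + β) → ∀ t → E t ≡ (1ℚ - ρ ^ t) * c
affine-recurrence {c = c} E fixed E₀ recurrence zero = trans E₀ (sym (*-zeroˡ c))
affine-recurrence {ρ} {β} {c} E fixed E₀ recurrence (suc t) = begin
  E (suc t)
    ≡⟨ recurrence t ⟩
  ρ * E t + β
    ≡⟨ cong₂ (λ a b → ρ * a + b) (affine-recurrence E fixed E₀ recurrence t) (sym fixed) ⟩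
  ρ * ((1ℚ - ρ ^ t) * c) + (1ℚ - ρ) * c
    ≡⟨ solve 3 (λ ρ r c → ρ :* ((con 1ℚ :- r) :* c) :+ (con 1ℚ :- ρ) :* c := (con 1ℚ :- ρ :* r) :* c)
               refl ρ (ρ ^ t) c ⟩
  (1ℚ - ρ * ρ ^ t) * c ∎

inv-fixed-point : ∀ r m → (1ℚ - ℕ→ℚ m * inv (suc r ℕ.+ m)) * inv (suc r) ≡ inv (suc r ℕ.+ m)
inv-fixed-point r m = begin
  (1ℚ - M * i) * j                 ≡⟨ cong (λ z → (z - M * i) * j) (sym i[r+m]≡1) ⟩
  (i * (ℕ→ℚ (suc r) + M) - M * i) * j
                                   ≡⟨ solve 4 (λ i r M j → (i :* (r :+ M) :- M :* i) :* j := i :* (j :* r))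
                                              refl i (ℕ→ℚ (suc r)) M j ⟩
  i * (j * ℕ→ℚ (suc r))            ≡⟨ cong (i *_) (inv-inverseˡ r) ⟩
  i * 1ℚ                           ≡⟨ *-identityʳ i ⟩
  i                                ∎
  where
  i = inv (suc r ℕ.+ m)
  j = inv (suc r)
  M = ℕ→ℚ m
  i[r+m]≡1 : i * (ℕ→ℚ (suc r) + M) ≡ 1ℚ
  i[r+m]≡1 = trans (cong (i *_) (sym (ℕ→ℚ-+ (suc r) m))) (inv-inverseˡ (r ℕ.+ m))

Σ : ℕ → (ℕ → ℚ) → ℚ
Σ K f = sum {K} (f ∘ toℕ)

Σ-cong : ∀ K {f g} → (∀ k → k < K → f k ≡ g k) → Σ K f ≡ Σ K g
Σ-cong K f≡g = sum-cong-≗ {K} (λ i → f≡g (toℕ i) (toℕ<n i))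

Σ-distrib-+ : ∀ K f g → Σ K (λ k → f k + g k) ≡ Σ K f + Σ K g
Σ-distrib-+ K f g = ∑-distrib-+ {K} (f ∘ toℕ) (g ∘ toℕ)

*-distribˡ-Σ : ∀ K x f → x * Σ K f ≡ Σ K (λ k → x * f k)
*-distribˡ-Σ K x f = *-distribˡ-sum {K} x (f ∘ toℕ)

Σ-comm : ∀ A B (f : ℕ → ℕ → ℚ) → Σ A (λ i → Σ B (f i)) ≡ Σ B (λ j → Σ A (λ i → f i j))
Σ-comm A B f = ∑-comm {A} {B} (λ i j → f (toℕ i) (toℕ j))

Σ-const : ∀ K {f} x → (∀ k → k < K → f k ≡ x) → Σ K f ≡ ℕ→ℚ K * x
Σ-const K x f≡x = trans (Σ-cong K f≡x) (trans (sum-replicate K) (·≡ℕ→ℚ* K x))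

Σ-zero : ∀ K {f} → (∀ k → k < K → f k ≡ 0ℚ) → Σ K f ≡ 0ℚ
Σ-zero K f≡0 = trans (Σ-cong K f≡0) (sum-replicate-zero K)

Σ-init-last : ∀ K f → Σ (suc K) f ≡ Σ K f + f K
Σ-init-last K f = trans (sum-init-last {K} (f ∘ toℕ))
  (cong₂ _+_ (sum-cong-≗ {K} (λ i → cong f (toℕ-inject₁ i))) (cong f (toℕ-fromℕ K)))

Σ-distrib-+₃ : ∀ K f g h → Σ K (λ k → f k + g k + h k) ≡ Σ K f + Σ K g + Σ K h
Σ-distrib-+₃ K f g h = trans (Σ-distrib-+ K (λ k → f k + g k) h) (cong (_+ Σ K h) (Σ-distrib-+ K f g))

Σ-split : ∀ a b f → Σ (a ℕ.+ b) f ≡ Σ a f + Σ b (λ j → f (a ℕ.+ j))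
Σ-split zero    b f = sym (+-identityˡ _)
Σ-split (suc a) b f = trans (cong (f 0 +_) (Σ-split a b (f ∘ suc))) (sym (+-assoc (f 0) _ _))

sumℚ-map-applyUpTo : ∀ (h : ℕ → ℚ) f K → sumℚ (map h (applyUpTo f K)) ≡ Σ K (h ∘ f)
sumℚ-map-applyUpTo h f zero    = refl
sumℚ-map-applyUpTo h f (suc K) = cong (h (f 0) +_) (sumℚ-map-applyUpTo h (f ∘ suc) K)

-- Binomial probabilities

binomial : ℕ → ℚ → ℕ → ℚ
binomial m q k = ℕ→ℚ (m C k) * q ^ k * (1ℚ - q) ^ (m ∸ k)

Σ-binomial : ∀ m q → Σ (suc m) (binomial m q) ≡ 1ℚ
Σ-binomial m q = begin
  Σ (suc m) (binomial m q)      ≡⟨ Σ-cong (suc m) (λ k _ → binomial≡term k) ⟩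
  Σ (suc m) (λ k → (m C k) · (q Exp.^ k * p Exp.^ (m ∸ k)))
                                ≡⟨⟩
  binomialExpansion q p m       ≡⟨ sym (theorem m q p) ⟩
  (q + p) Exp.^ m               ≡⟨ cong (Exp._^ m) (solve 1 (λ q → q :+ (con 1ℚ :- q) := con 1ℚ) refl q) ⟩
  1ℚ Exp.^ m                    ≡⟨ sym (^≡Exp^ 1ℚ m) ⟩
  1ℚ ^ m                        ≡⟨ 1^k≡1 m ⟩
  1ℚ                            ∎
  where
  p = 1ℚ - q
  binomial≡term : ∀ k → binomial m q k ≡ (m C k) · (q Exp.^ k * p Exp.^ (m ∸ k))
  binomial≡term k = begin
    ℕ→ℚ (m C k) * q ^ k * p ^ (m ∸ k)             ≡⟨ *-assoc (ℕ→ℚ (m C k)) (q ^ k) (p ^ (m ∸ k)) ⟩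
    ℕ→ℚ (m C k) * (q ^ k * p ^ (m ∸ k))           ≡⟨ sym (·≡ℕ→ℚ* (m C k) _) ⟩
    (m C k) · (q ^ k * p ^ (m ∸ k))
      ≡⟨ cong₂ (λ a b → (m C k) · (a * b)) (^≡Exp^ q k) (^≡Exp^ p (m ∸ k)) ⟩
    (m C k) · (q Exp.^ k * p Exp.^ (m ∸ k))       ∎

binomial-beyond : ∀ m q → binomial m q (suc m) ≡ 0ℚ
binomial-beyond m q rewrite k>n⇒nCk≡0 (ℕₚ.n<1+n m) =
  trans (cong (_* (1ℚ - q) ^ (m ∸ suc m)) (*-zeroˡ (q ^ suc m))) (*-zeroˡ ((1ℚ - q) ^ (m ∸ suc m)))

C-absorption : ∀ m k → (m C suc k) ℕ.* suc k ≡ (m C k) ℕ.* (m ∸ k)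
C-absorption zero    k       = sym (trans (cong ((0 C k) ℕ.*_) (ℕₚ.0∸n≡0 k)) (ℕₚ.*-zeroʳ (0 C k)))
C-absorption (suc m) zero    = trans (ℕₚ.*-identityʳ _) (trans (nC1≡n (suc m)) (sym (ℕₚ.*-identityˡ (suc m))))
C-absorption (suc m) (suc k) = begin
  (suc m C suc (suc k)) ℕ.* suc (suc k)
    ≡⟨ cong (ℕ._* suc (suc k)) (sym (nCk+nC[k+1]≡[n+1]C[k+1] m (suc k))) ⟩
  (m C suc k ℕ.+ m C suc (suc k)) ℕ.* suc (suc k)
    ≡⟨ ℕₚ.*-distribʳ-+ (suc (suc k)) (m C suc k) _ ⟩
  (m C suc k) ℕ.* suc (suc k) ℕ.+ (m C suc (suc k)) ℕ.* suc (suc k)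
    ≡⟨ cong ((m C suc k) ℕ.* suc (suc k) ℕ.+_) (C-absorption m (suc k)) ⟩
  (m C suc k) ℕ.* suc (suc k) ℕ.+ (m C suc k) ℕ.* (m ∸ suc k)
    ≡⟨ sym (ℕₚ.*-distribˡ-+ (m C suc k) (suc (suc k)) _) ⟩
  (m C suc k) ℕ.* (suc (suc k) ℕ.+ (m ∸ suc k))
    ≡⟨ cong ((m C suc k) ℕ.*_) (sym (ℕₚ.+-suc (suc k) (m ∸ suc k))) ⟩
  (m C suc k) ℕ.* (suc k ℕ.+ suc (m ∸ suc k))
    ≡⟨ ℕₚ.*-distribˡ-+ (m C suc k) (suc k) _ ⟩
  (m C suc k) ℕ.* suc k ℕ.+ (m C suc k) ℕ.* suc (m ∸ suc k)
    ≡⟨ cong₂ ℕ._+_ (C-absorption m k) shift ⟩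
  (m C k) ℕ.* (m ∸ k) ℕ.+ (m C suc k) ℕ.* (m ∸ k)
    ≡⟨ sym (ℕₚ.*-distribʳ-+ (m ∸ k) (m C k) _) ⟩
  (m C k ℕ.+ m C suc k) ℕ.* (m ∸ k)
    ≡⟨ cong (ℕ._* (m ∸ k)) (nCk+nC[k+1]≡[n+1]C[k+1] m k) ⟩
  (suc m C suc k) ℕ.* (m ∸ k) ∎
  where
  shift : (m C suc k) ℕ.* suc (m ∸ suc k) ≡ (m C suc k) ℕ.* (m ∸ k)
  shift with k ℕₚ.<? m
  ... | yes k<m = cong ((m C suc k) ℕ.*_) (sym (ℕₚ.+-∸-assoc 1 k<m))
  ... | no  k≮m rewrite k>n⇒nCk≡0 (ℕₚ.≰⇒> k≮m) = refl

^-pred-scaled : ∀ x t → x ^ t * ℕ→ℚ t ≡ x * x ^ pred t * ℕ→ℚ t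
^-pred-scaled x zero    = trans (*-zeroʳ (x ^ 0)) (sym (*-zeroʳ (x * x ^ 0)))
^-pred-scaled x (suc t) = refl

binomial-absorption : ∀ m q k →
  q * binomial m q k * ℕ→ℚ (m ∸ k) ≡ (1ℚ - q) * binomial m q (suc k) * ℕ→ℚ (suc k)
binomial-absorption m q k = begin
  q * (c * a * p ^ (m ∸ k)) * d
    ≡⟨ solve 5 (λ q c a P d → q :* (c :* a :* P) :* d := q :* a :* c :* (P :* d)) refl q c a (p ^ (m ∸ k)) d ⟩
  q * a * c * (p ^ (m ∸ k) * d)
    ≡⟨ cong (q * a * c *_) peel ⟩
  q * a * c * (p * b * d)
    ≡⟨ solve 6 (λ q a c p b d → q :* a :* c :* (p :* b :* d) := p :* (q :* a) :* b :* (c :* d)) refl q a c p b d ⟩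
  p * (q * a) * b * (c * d)
    ≡⟨ cong (p * (q * a) * b *_) absorb ⟩
  p * (q * a) * b * (c′ * e)
    ≡⟨ solve 5 (λ p qa b c′ e → p :* qa :* b :* (c′ :* e) := p :* (c′ :* qa :* b) :* e)
               refl p (q * a) b c′ e ⟩
  p * (c′ * (q * a) * b) * e ∎
  where
  p = 1ℚ - q
  a = q ^ k
  b = p ^ (m ∸ suc k)
  c = ℕ→ℚ (m C k)
  c′ = ℕ→ℚ (m C suc k)
  d = ℕ→ℚ (m ∸ k)
  e = ℕ→ℚ (suc k)
  peel : p ^ (m ∸ k) * d ≡ p * b * d
  peel = trans (^-pred-scaled p (m ∸ k)) (cong (λ t → p * p ^ t * d) (ℕₚ.pred[m∸n]≡m∸[1+n] m k))
  absorb : c * d ≡ c′ * e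
  absorb = trans (sym (ℕ→ℚ-* (m C k) (m ∸ k)))
                 (trans (cong ℕ→ℚ (sym (C-absorption m k))) (ℕ→ℚ-* (m C suc k) (suc k)))

Σ-binomial-shift : ∀ m q (g : ℕ → ℚ) →
  Σ (suc m) (λ k → q * binomial m q k * ℕ→ℚ (m ∸ k) * g (suc k))
    ≡ Σ (suc m) (λ k → (1ℚ - q) * binomial m q k * ℕ→ℚ k * g k)
Σ-binomial-shift m q g = begin
  Σ (suc m) (λ k → q * binomial m q k * ℕ→ℚ (m ∸ k) * g (suc k))
    ≡⟨ Σ-cong (suc m) (λ k _ → cong (_* g (suc k)) (binomial-absorption m q k)) ⟩
  Σ (suc m) (h ∘ suc)           ≡⟨ Σ-init-last m (h ∘ suc) ⟩
  Σ m (h ∘ suc) + h (suc m)     ≡⟨ cong (Σ m (h ∘ suc) +_) h-beyond ⟩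
  Σ m (h ∘ suc) + 0ℚ            ≡⟨ solve 1 (λ s → s :+ con 0ℚ := con 0ℚ :+ s) refl (Σ m (h ∘ suc)) ⟩
  0ℚ + Σ m (h ∘ suc)            ≡⟨ cong (_+ Σ m (h ∘ suc)) (sym h-zero) ⟩
  Σ (suc m) h                   ∎
  where
  h : ℕ → ℚ
  h k = (1ℚ - q) * binomial m q k * ℕ→ℚ k * g k
  h-zero : h 0 ≡ 0ℚ
  h-zero = trans (cong (_* g 0) (*-zeroʳ ((1ℚ - q) * binomial m q 0))) (*-zeroˡ (g 0))
  h-beyond : h (suc m) ≡ 0ℚ
  h-beyond rewrite binomial-beyond m q =
    solve 3 (λ p n x → p :* con 0ℚ :* n :* x := con 0ℚ) refl (1ℚ - q) (ℕ→ℚ (suc m)) (g (suc m))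

binomial-balance : ∀ m q (e : ℕ → ℚ) →
    q * Σ (suc m) (λ k → binomial m q k * (ℕ→ℚ k * e k + 1ℚ + ℕ→ℚ (m ∸ k) * e (suc k)))
  + (1ℚ - q) * Σ (suc m) (λ k → binomial m q k * (ℕ→ℚ k * e (k ∸ 1) + 1ℚ + ℕ→ℚ (m ∸ k) * e k))
  ≡ ℕ→ℚ m * Σ (suc m) (λ k → binomial m q k * e k) + 1ℚ
binomial-balance m q e = begin
  q * Σ K (λ k → w k * E₁ k) + p * Σ K (λ k → w k * E₂ k)
    ≡⟨ cong₂ _+_ (*-distribˡ-Σ K q (λ k → w k * E₁ k)) (*-distribˡ-Σ K p (λ k → w k * E₂ k)) ⟩
  Σ K (λ k → q * (w k * E₁ k)) + Σ K (λ k → p * (w k * E₂ k))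
    ≡⟨ sym (Σ-distrib-+ K (λ k → q * (w k * E₁ k)) (λ k → p * (w k * E₂ k))) ⟩
  Σ K (λ k → q * (w k * E₁ k) + p * (w k * E₂ k))
    ≡⟨ Σ-cong K (λ k _ → separate k) ⟩
  Σ K (λ k → up k + down k + rest k)
    ≡⟨ Σ-distrib-+₃ K up down rest ⟩
  Σ K up + Σ K down + Σ K rest
    ≡⟨ cong₂ (λ a b → a + b + Σ K rest)
             (Σ-binomial-shift m q e) (sym (Σ-binomial-shift m q (λ k → e (k ∸ 1)))) ⟩
  Σ K up′ + Σ K down′ + Σ K rest
    ≡⟨ sym (Σ-distrib-+₃ K up′ down′ rest) ⟩
  Σ K (λ k → up′ k + down′ k + rest k)
    ≡⟨ Σ-cong K (λ k k<K → collect k (ℕₚ.≤-pred k<K)) ⟩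
  Σ K (λ k → ℕ→ℚ m * (w k * e k) + w k)
    ≡⟨ Σ-distrib-+ K (λ k → ℕ→ℚ m * (w k * e k)) w ⟩
  Σ K (λ k → ℕ→ℚ m * (w k * e k)) + Σ K w
    ≡⟨ cong₂ _+_ (sym (*-distribˡ-Σ K (ℕ→ℚ m) (λ k → w k * e k))) (Σ-binomial m q) ⟩
  ℕ→ℚ m * Σ K (λ k → w k * e k) + 1ℚ ∎
  where
  K = suc m
  p = 1ℚ - q
  w = binomial m q
  E₁ E₂ up down rest up′ down′ : ℕ → ℚ
  E₁ k = ℕ→ℚ k * e k + 1ℚ + ℕ→ℚ (m ∸ k) * e (suc k)
  E₂ k = ℕ→ℚ k * e (k ∸ 1) + 1ℚ + ℕ→ℚ (m ∸ k) * e k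
  up k = q * w k * ℕ→ℚ (m ∸ k) * e (suc k)
  down k = p * w k * ℕ→ℚ k * e (k ∸ 1)
  rest k = (q * ℕ→ℚ k + p * ℕ→ℚ (m ∸ k)) * (w k * e k) + w k
  up′ k = p * w k * ℕ→ℚ k * e k
  down′ k = q * w k * ℕ→ℚ (m ∸ k) * e k

  separate : ∀ k → q * (w k * E₁ k) + p * (w k * E₂ k) ≡ up k + down k + rest k
  separate k = solve 7 (λ q w i j e₀ e₊ e₋ →
      q :* (w :* (i :* e₀ :+ con 1ℚ :+ j :* e₊)) :+ (con 1ℚ :- q) :* (w :* (i :* e₋ :+ con 1ℚ :+ j :* e₀))
        := q :* w :* j :* e₊ :+ (con 1ℚ :- q) :* w :* i :* e₋ :+ ((q :* i :+ (con 1ℚ :- q) :* j) :* (w :* e₀) :+ w))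
    refl q (w k) (ℕ→ℚ k) (ℕ→ℚ (m ∸ k)) (e k) (e (suc k)) (e (k ∸ 1))

  collect : ∀ k → k ≤ m → up′ k + down′ k + rest k ≡ ℕ→ℚ m * (w k * e k) + w k
  collect k k≤m = begin
    up′ k + down′ k + rest k
      ≡⟨ solve 5 (λ q w i j e₀ →
           (con 1ℚ :- q) :* w :* i :* e₀ :+ q :* w :* j :* e₀ :+ ((q :* i :+ (con 1ℚ :- q) :* j) :* (w :* e₀) :+ w)
             := (i :+ j) :* (w :* e₀) :+ w)
         refl q (w k) (ℕ→ℚ k) (ℕ→ℚ (m ∸ k)) (e k) ⟩
    (ℕ→ℚ k + ℕ→ℚ (m ∸ k)) * (w k * e k) + w k
      ≡⟨ cong (λ z → z * (w k * e k) + w k)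
              (trans (sym (ℕ→ℚ-+ k (m ∸ k))) (cong ℕ→ℚ (ℕₚ.m+[n∸m]≡n k≤m))) ⟩
    ℕ→ℚ m * (w k * e k) + w k ∎

-- Windows of consecutive cards

-- window r X i lists x_i, …, x_{i+r-1}; card reads 0 outside the deck, hence the length hypotheses below.
window : ℕ → Deck → ℕ → List ℕ
window zero    X i = []
window (suc r) X i = card X i ∷ window r X (suc i)

length-window : ∀ r X i → length (window r X i) ≡ r
length-window zero    X i = refl
length-window (suc r) X i = cong suc (length-window r X (suc i))

window-∷ : ∀ r x xs i → window r (x ∷ xs) (suc (suc i)) ≡ window r xs (suc i)
window-∷ zero    x xs i = refl
window-∷ (suc r) x xs i = cong (card xs (suc i) ∷_) (window-∷ r x xs (suc i))

window-take-drop : ∀ r i Y → i ℕ.+ r ≤ length Y → window r Y (suc i) ≡ take r (drop i Y)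
window-take-drop zero    zero    Y       _       = refl
window-take-drop (suc r) zero    (y ∷ Y) (s≤s h) = cong (y ∷_) (trans (window-∷ r y Y 0) (window-take-drop r 0 Y h))
window-take-drop r       (suc i) (y ∷ Y) (s≤s h) = trans (window-∷ r y Y i) (window-take-drop r i Y h)

window-++ : ∀ r i Y Z → i ℕ.+ r ≤ length Y → window r (Y ++ Z) (suc i) ≡ window r Y (suc i)
window-++ zero    zero    Y       Z _       = refl
window-++ (suc r) zero    (y ∷ Y) Z (s≤s h) =
  cong (y ∷_) (trans (window-∷ r y (Y ++ Z) 0) (trans (window-++ r 0 Y Z h) (sym (window-∷ r y Y 0))))
window-++ r       (suc i) (y ∷ Y) Z (s≤s h) =
  trans (window-∷ r y (Y ++ Z) i) (trans (window-++ r i Y Z h) (sym (window-∷ r y Y i)))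

insertAt-zero : ∀ c Y → insertAt 0 c Y ≡ c ∷ Y
insertAt-zero c []      = refl
insertAt-zero c (y ∷ Y) = refl

window-insert-before : ∀ r i j c Y → j < i → window r (insertAt j c Y) (suc i) ≡ window r Y i
window-insert-before r (suc i)       zero    c Y       _ =
  trans (cong (λ X → window r X (suc (suc i))) (insertAt-zero c Y)) (window-∷ r c Y i)
window-insert-before r (suc i)       (suc j) c []      _ = window-∷ r c [] i
window-insert-before r (suc (suc i)) (suc j) c (y ∷ Y) (s≤s j<i) =
  trans (window-∷ r y (insertAt j c Y) (suc i))
        (trans (window-insert-before r (suc i) j c Y j<i) (sym (window-∷ r y Y i)))

window-insert-after : ∀ r i j c Y → i ℕ.+ r ≤ length Y →
  window r (insertAt (i ℕ.+ r ℕ.+ j) c Y) (suc i) ≡ window r Y (suc i)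
window-insert-after zero    zero    j c Y       _       = refl
window-insert-after (suc r) zero    j c (y ∷ Y) (s≤s h) =
  cong (y ∷_) (trans (window-∷ r y _ 0) (trans (window-insert-after r 0 j c Y h) (sym (window-∷ r y Y 0))))
window-insert-after r       (suc i) j c (y ∷ Y) (s≤s h) =
  trans (window-∷ r y _ i) (trans (window-insert-after r i j c Y h) (sym (window-∷ r y Y i)))

window-insert-within : ∀ r i d c Y → d ≤ r → i ℕ.+ r ≤ length Y →
  window (suc r) (insertAt (i ℕ.+ d) c Y) (suc i) ≡ insertAt d c (window r Y (suc i))
window-insert-within r zero zero c Y _ _ =
  trans (cong (λ X → window (suc r) X 1) (insertAt-zero c Y))
        (trans (cong (c ∷_) (window-∷ r c Y 0)) (sym (insertAt-zero c (window r Y 1))))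
window-insert-within (suc r) zero (suc d) c (y ∷ Y) (s≤s d≤r) (s≤s h) =
  cong (y ∷_) (trans (window-∷ (suc r) y (insertAt d c Y) 0)
              (trans (window-insert-within r 0 d c Y d≤r h) (cong (insertAt d c) (sym (window-∷ r y Y 0)))))
window-insert-within r (suc i) d c (y ∷ Y) d≤r (s≤s h) =
  trans (window-∷ (suc r) y (insertAt (i ℕ.+ d) c Y) i)
        (trans (window-insert-within r i d c Y d≤r h) (cong (insertAt d c) (sym (window-∷ r y Y i))))

-- Decks

IsDeck : ℕ → Deck → Set
IsDeck n X = X ↭ ascending n

ascending-increasing : ∀ n → AllPairs _<_ (ascending n)
ascending-increasing n = AllPairsₚ.map⁺ (AllPairsₚ.applyUpTo⁺₁ id n (λ i<j _ → s<s i<j))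

length-ascending : ∀ n → length (ascending n) ≡ n
length-ascending n = trans (length-map suc (upTo n)) (length-upTo n)

deck-unique : ∀ {n X} → IsDeck n X → Unique X
deck-unique {n} X↭ = Unique-resp-↭ (↭⇒↭ₛ (↭-sym X↭)) (AllPairs.map ℕₚ.<⇒≢ (ascending-increasing n))

deck-length : ∀ {n X} → IsDeck n X → length X ≡ n
deck-length {n} X↭ = trans (↭-length X↭) (length-ascending n)

insertAt-↭ : ∀ j c Y → insertAt j c Y ↭ c ∷ Y
insertAt-↭ j       c []      = ↭-refl
insertAt-↭ zero    c (y ∷ Y) = ↭-refl
insertAt-↭ (suc j) c (y ∷ Y) = ↭-trans (↭-prep y (insertAt-↭ j c Y)) (↭-swap y c ↭-refl)

removeBottom-∷ʳ : ∀ x xs → proj₁ (removeBottom (x ∷ xs)) ∷ʳ proj₂ (removeBottom (x ∷ xs)) ≡ x ∷ xs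
removeBottom-∷ʳ x []       = refl
removeBottom-∷ʳ x (y ∷ xs) with removeBottom (y ∷ xs) | removeBottom-∷ʳ y xs
... | Y , b | Y∷ʳb≡y∷xs = cong (x ∷_) Y∷ʳb≡y∷xs

bottom∷rest-↭ : ∀ x xs → proj₂ (removeBottom (x ∷ xs)) ∷ proj₁ (removeBottom (x ∷ xs)) ↭ x ∷ xs
bottom∷rest-↭ x xs = ↭-trans (∷↭∷ʳ _ _) (↭-reflexive (removeBottom-∷ʳ x xs))

stepDeck-↭ : ∀ n q X → All ((_↭ X) ∘ proj₂) (stepDeck n q X)
stepDeck-↭ n q []       = []
stepDeck-↭ n q (x ∷ xs) = Allₚ.++⁺
  (Allₚ.map⁺ (All.universal (λ j → insertAt-↭ j x xs) (positions n)))
  (Allₚ.map⁺ (All.universal (λ j → ↭-trans (insertAt-↭ j _ _) (bottom∷rest-↭ x xs)) (positions n)))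

law-decks : ∀ n q t → All (IsDeck n ∘ proj₂) (law n q t)
law-decks n q zero    = ↭-refl ∷ []
law-decks n q (suc t) = step-decks (law-decks n q t)
  where
  step-decks : ∀ {μ} → All (IsDeck n ∘ proj₂) μ → All (IsDeck n ∘ proj₂) (step n q μ)
  step-decks []                        = []
  step-decks {(w , d) ∷ μ} (d↭ ∷ decks) =
    Allₚ.++⁺ (Allₚ.map⁺ (All.map (λ d′↭d → ↭-trans d′↭d d↭) (stepDeck-↭ n q d))) (step-decks decks)

-- Expectations

𝔼-++ : ∀ μ ν F → 𝔼 (μ ++ ν) F ≡ 𝔼 μ F + 𝔼 ν F
𝔼-++ []            ν F = sym (+-identityˡ (𝔼 ν F))
𝔼-++ ((w , d) ∷ μ) ν F = trans (cong (w * F d +_) (𝔼-++ μ ν F)) (sym (+-assoc (w * F d) (𝔼 μ F) (𝔼 ν F)))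

𝔼-scale : ∀ w μ F → 𝔼 (map (λ z → w * proj₁ z , proj₂ z) μ) F ≡ w * 𝔼 μ F
𝔼-scale w []            F = sym (*-zeroʳ w)
𝔼-scale w ((p , d) ∷ μ) F = trans (cong (w * p * F d +_) (𝔼-scale w μ F))
  (solve 4 (λ w p f e → w :* p :* f :+ w :* e := w :* (p :* f :+ e)) refl w p (F d) (𝔼 μ F))

𝔼-step : ∀ n q μ F → 𝔼 (step n q μ) F ≡ 𝔼 μ (λ d → 𝔼 (stepDeck n q d) F)
𝔼-step n q []            F = refl
𝔼-step n q ((w , d) ∷ μ) F =
  trans (𝔼-++ (map (λ z → w * proj₁ z , proj₂ z) (stepDeck n q d)) (step n q μ) F)
        (cong₂ _+_ (𝔼-scale w (stepDeck n q d) F) (𝔼-step n q μ F))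

𝔼-positions : ∀ n c (D : ℕ → Deck) F → 𝔼 (map (λ j → c , D j) (positions n)) F ≡ c * Σ n (F ∘ D)
𝔼-positions n c D F = begin
  𝔼 (map (λ j → c , D j) (upTo n)) F          ≡⟨ cong sumℚ (sym (map-∘ (upTo n))) ⟩
  sumℚ (map (λ j → c * F (D j)) (upTo n))     ≡⟨ sumℚ-map-applyUpTo (λ j → c * F (D j)) id n ⟩
  Σ n (λ j → c * F (D j))                     ≡⟨ sym (*-distribˡ-Σ n c (F ∘ D)) ⟩
  c * Σ n (F ∘ D)                             ∎

𝔼-stepDeck : ∀ n q x xs F → 𝔼 (stepDeck n q (x ∷ xs)) F ≡
  q * inv n * Σ n (λ j → F (insertAt j x xs))
    + (1ℚ - q) * inv n
      * Σ n (λ j → F (insertAt j (proj₂ (removeBottom (x ∷ xs))) (proj₁ (removeBottom (x ∷ xs)))))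
𝔼-stepDeck n q x xs F =
  trans (𝔼-++ (map _ (positions n)) _ F) (cong₂ _+_ (𝔼-positions n _ _ F) (𝔼-positions n _ _ F))

𝔼-cong : ∀ {Q : Deck → Set} {μ F G} → All (Q ∘ proj₂) μ → (∀ {d} → Q d → F d ≡ G d) →
  𝔼 μ F ≡ 𝔼 μ G
𝔼-cong                   []       F≡G = refl
𝔼-cong {μ = (w , d) ∷ μ} (Qd ∷ Qμ) F≡G = cong₂ (λ a b → w * a + b) (F≡G Qd) (𝔼-cong Qμ F≡G)

𝔼-affine : ∀ μ a b F → 𝔼 μ (λ d → a * F d + b) ≡ a * 𝔼 μ F + b * 𝔼 μ (λ _ → 1ℚ)
𝔼-affine []            a b F = solve 2 (λ a b → con 0ℚ := a :* con 0ℚ :+ b :* con 0ℚ) refl a b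
𝔼-affine ((w , d) ∷ μ) a b F = trans (cong (w * (a * F d + b) +_) (𝔼-affine μ a b F))
  (solve 6 (λ w a b f e o → w :* (a :* f :+ b) :+ (a :* e :+ b :* o) := a :* (w :* f :+ e) :+ b :* (w :* con 1ℚ :+ o))
     refl w a b (F d) (𝔼 μ F) (𝔼 μ (λ _ → 1ℚ)))

law-mass : ∀ N q t → 𝔼 (law (suc N) q t) (λ _ → 1ℚ) ≡ 1ℚ
law-mass N q zero    = refl
law-mass N q (suc t) = begin
  𝔼 (step n q μ) one                         ≡⟨ 𝔼-step n q μ one ⟩
  𝔼 μ (λ d → 𝔼 (stepDeck n q d) one)         ≡⟨ 𝔼-cong (law-decks n q t) stepDeck-mass ⟩
  𝔼 μ one                                    ≡⟨ law-mass N q t ⟩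
  1ℚ                                         ∎
  where
  n = suc N
  μ = law n q t
  one : Deck → ℚ
  one _ = 1ℚ
  stepDeck-mass : ∀ {X} → IsDeck n X → 𝔼 (stepDeck n q X) one ≡ 1ℚ
  stepDeck-mass {[]}     X↭ = contradiction (deck-length X↭) ℕₚ.0≢1+n
  stepDeck-mass {x ∷ xs} X↭ = begin
    𝔼 (stepDeck n q (x ∷ xs)) one
      ≡⟨ 𝔼-stepDeck n q x xs one ⟩
    q * inv n * Σ n (λ _ → 1ℚ) + (1ℚ - q) * inv n * Σ n (λ _ → 1ℚ)
      ≡⟨ cong (λ z → q * inv n * z + (1ℚ - q) * inv n * z) (Σ-const n 1ℚ (λ _ _ → refl)) ⟩
    q * inv n * (ℕ→ℚ n * 1ℚ) + (1ℚ - q) * inv n * (ℕ→ℚ n * 1ℚ)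
      ≡⟨ solve 3 (λ q i c → q :* i :* (c :* con 1ℚ) :+ (con 1ℚ :- q) :* i :* (c :* con 1ℚ) := i :* c)
                 refl q (inv n) (ℕ→ℚ n) ⟩
    inv n * ℕ→ℚ n
      ≡⟨ inv-inverseˡ N ⟩
    1ℚ ∎

-- Patterns

𝟙 : Bool → ℚ
𝟙 true  = 1ℚ
𝟙 false = 0ℚ

ExactlyOneInsertion : ℕ → (List ℕ → Bool) → Set
ExactlyOneInsertion s P =
  ∀ c w → length w ≡ s → Unique (c ∷ w) → Σ (suc s) (λ d → 𝟙 (P (insertAt d c w))) ≡ 1ℚ

AvoidsIncreasing : (List ℕ → Bool) → Set
AvoidsIncreasing P = ∀ w → AllPairs _<_ w → P w ≡ false

k+s≤s+m : ∀ s {k m} → k ≤ m → k ℕ.+ s ≤ s ℕ.+ m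
k+s≤s+m s {k} {m} k≤m = subst (k ℕ.+ s ≤_) (ℕₚ.+-comm m s) (ℕₚ.+-monoˡ-≤ s k≤m)

k+[1+s]≤s+m : ∀ s {k m} → k < m → k ℕ.+ suc s ≤ s ℕ.+ m
k+[1+s]≤s+m s {k} {m} k<m = subst (_≤ s ℕ.+ m) (sym (ℕₚ.+-suc k s)) (k+s≤s+m s k<m)

m∸k>0⇒k<m : ∀ {m k} → 0 < m ∸ k → k < m
m∸k>0⇒k<m = ℕₚ.m∸n≢0⇒n<m ∘ ℕₚ.n>0⇒n≢0

module Pattern (s : ℕ) (P : List ℕ → Bool) (exactly-one : ExactlyOneInsertion s P) where

  occurs : Deck → ℕ → ℚ
  occurs X i = 𝟙 (P (window (suc s) X i))

  patternStat : ℕ → ℚ → Deck → ℚ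
  patternStat m q X = Σ (suc m) (λ k → binomial m q k * occurs X (suc k))

  insertion-count : ∀ m k c Y → Unique (c ∷ Y) → length Y ≡ s ℕ.+ m → k ≤ m →
    Σ (suc s ℕ.+ m) (λ j → occurs (insertAt j c Y) (suc k))
      ≡ ℕ→ℚ k * occurs Y k + 1ℚ + ℕ→ℚ (m ∸ k) * occurs Y (suc k)
  insertion-count m k c Y (c∉Y ∷ Y!) |Y| k≤m = begin
    Σ (suc s ℕ.+ m) f
      ≡⟨ cong (λ N → Σ N f) size ⟩
    Σ (k ℕ.+ suc s ℕ.+ (m ∸ k)) f
      ≡⟨ Σ-split (k ℕ.+ suc s) (m ∸ k) f ⟩
    Σ (k ℕ.+ suc s) f + Σ (m ∸ k) (λ j → f (k ℕ.+ suc s ℕ.+ j))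
      ≡⟨ cong (_+ Σ (m ∸ k) (λ j → f (k ℕ.+ suc s ℕ.+ j))) (Σ-split k (suc s) f) ⟩
    Σ k f + Σ (suc s) (λ d → f (k ℕ.+ d)) + Σ (m ∸ k) (λ j → f (k ℕ.+ suc s ℕ.+ j))
      ≡⟨ cong₂ _+_ (cong₂ _+_ before within) after ⟩
    ℕ→ℚ k * occurs Y k + 1ℚ + ℕ→ℚ (m ∸ k) * occurs Y (suc k) ∎
    where
    f : ℕ → ℚ
    f j = occurs (insertAt j c Y) (suc k)

    size : suc s ℕ.+ m ≡ k ℕ.+ suc s ℕ.+ (m ∸ k)
    size = trans (cong (suc s ℕ.+_) (sym (ℕₚ.m+[n∸m]≡n k≤m)))
                 (trans (sym (ℕₚ.+-assoc (suc s) k (m ∸ k))) (cong (ℕ._+ (m ∸ k)) (ℕₚ.+-comm (suc s) k)))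

    fits : ∀ {a} → a ≤ s ℕ.+ m → a ≤ length Y
    fits {a} = subst (a ≤_) (sym |Y|)

    before : Σ k f ≡ ℕ→ℚ k * occurs Y k
    before = Σ-const k (occurs Y k) (λ j j<k → cong (𝟙 ∘ P) (window-insert-before (suc s) k j c Y j<k))

    w = window s Y (suc k)

    c∷w-unique : Unique (c ∷ w)
    c∷w-unique rewrite window-take-drop s k Y (fits (k+s≤s+m s k≤m)) =
      Allₚ.take⁺ s (Allₚ.drop⁺ k c∉Y) ∷ Uniqueₚ.take⁺ s (Uniqueₚ.drop⁺ k Y!)

    within : Σ (suc s) (λ d → f (k ℕ.+ d)) ≡ 1ℚ
    within = trans
      (Σ-cong (suc s) (λ d d<1+s → cong (𝟙 ∘ P)
        (window-insert-within s k d c Y (ℕₚ.≤-pred d<1+s) (fits (k+s≤s+m s k≤m)))))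
      (exactly-one c w (length-window s Y (suc k)) c∷w-unique)

    after : Σ (m ∸ k) (λ j → f (k ℕ.+ suc s ℕ.+ j)) ≡ ℕ→ℚ (m ∸ k) * occurs Y (suc k)
    after = Σ-const (m ∸ k) (occurs Y (suc k)) (λ j j<m∸k →
      cong (𝟙 ∘ P) (window-insert-after (suc s) k j c Y
        (fits (k+[1+s]≤s+m s (m∸k>0⇒k<m (ℕₚ.<-≤-trans z<s j<m∸k))))))

  Σ-insertions : ∀ m q c Y → IsDeck (suc s ℕ.+ m) (c ∷ Y) →
    Σ (suc s ℕ.+ m) (λ j → patternStat m q (insertAt j c Y))
      ≡ Σ (suc m) (λ k → binomial m q k * (ℕ→ℚ k * occurs Y k + 1ℚ + ℕ→ℚ (m ∸ k) * occurs Y (suc k)))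
  Σ-insertions m q c Y deck = begin
    Σ n (λ j → Σ (suc m) (λ k → w k * occurs (insertAt j c Y) (suc k)))
      ≡⟨ Σ-comm n (suc m) (λ j k → w k * occurs (insertAt j c Y) (suc k)) ⟩
    Σ (suc m) (λ k → Σ n (λ j → w k * occurs (insertAt j c Y) (suc k)))
      ≡⟨ Σ-cong (suc m) (λ k k<1+m → trans (sym (*-distribˡ-Σ n (w k) (λ j → occurs (insertAt j c Y) (suc k))))
           (cong (w k *_) (insertion-count m k c Y (deck-unique deck) |Y| (ℕₚ.≤-pred k<1+m)))) ⟩
    Σ (suc m) (λ k → w k * (ℕ→ℚ k * occurs Y k + 1ℚ + ℕ→ℚ (m ∸ k) * occurs Y (suc k))) ∎
    where
    n = suc s ℕ.+ m
    w = binomial m q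
    |Y| = ℕₚ.suc-injective (deck-length deck)

  occurs-∷ : ∀ x xs i → occurs (x ∷ xs) (suc (suc i)) ≡ occurs xs (suc i)
  occurs-∷ x xs i = cong (𝟙 ∘ P) (window-∷ (suc s) x xs i)

  occurs-∷ʳ : ∀ m b Y i → length Y ≡ s ℕ.+ m → i < m → occurs (Y ∷ʳ b) (suc i) ≡ occurs Y (suc i)
  occurs-∷ʳ m b Y i |Y| i<m =
    cong (𝟙 ∘ P) (window-++ (suc s) i Y (b ∷ []) (subst (_ ≤_) (sym |Y|) (k+[1+s]≤s+m s i<m)))

  Σ-top-insertions : ∀ m q x xs → IsDeck (suc s ℕ.+ m) (x ∷ xs) →
    Σ (suc s ℕ.+ m) (λ j → patternStat m q (insertAt j x xs))
      ≡ Σ (suc m) (λ k → binomial m q k * (ℕ→ℚ k * occurs (x ∷ xs) (suc k) + 1ℚ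
                                            + ℕ→ℚ (m ∸ k) * occurs (x ∷ xs) (suc (suc k))))
  Σ-top-insertions m q x xs X↭ = trans (Σ-insertions m q x xs X↭) (Σ-cong (suc m) (λ k _ →
    cong (binomial m q k *_) (cong₂ (λ a b → a + 1ℚ + b)
      (scale-cong k (shift k)) (cong (ℕ→ℚ (m ∸ k) *_) (sym (occurs-∷ x xs k))))))
    where
    shift : ∀ k → 0 < k → occurs xs k ≡ occurs (x ∷ xs) (suc k)
    shift (suc k) _ = sym (occurs-∷ x xs k)

  Σ-bottom-insertions : ∀ m q x xs → IsDeck (suc s ℕ.+ m) (x ∷ xs) →
    Σ (suc s ℕ.+ m)
      (λ j → patternStat m q (insertAt j (proj₂ (removeBottom (x ∷ xs))) (proj₁ (removeBottom (x ∷ xs)))))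
      ≡ Σ (suc m) (λ k → binomial m q k * (ℕ→ℚ k * occurs (x ∷ xs) (suc (k ∸ 1)) + 1ℚ
                                            + ℕ→ℚ (m ∸ k) * occurs (x ∷ xs) (suc k)))
  Σ-bottom-insertions m q x xs X↭ = trans (Σ-insertions m q b Y b∷Y↭) (Σ-cong (suc m) (λ k k<1+m →
    cong (binomial m q k *_) (cong₂ (λ a c → a + 1ℚ + c)
      (scale-cong k (shift k (ℕₚ.≤-pred k<1+m))) (scale-cong (m ∸ k) (shift′ k)))))
    where
    b = proj₂ (removeBottom (x ∷ xs))
    Y = proj₁ (removeBottom (x ∷ xs))
    b∷Y↭ = ↭-trans (bottom∷rest-↭ x xs) X↭
    restore : ∀ i → i < m → occurs Y (suc i) ≡ occurs (x ∷ xs) (suc i)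
    restore i i<m = trans (sym (occurs-∷ʳ m b Y i (ℕₚ.suc-injective (deck-length b∷Y↭)) i<m))
                          (cong (λ Z → occurs Z (suc i)) (removeBottom-∷ʳ x xs))
    shift : ∀ k → k ≤ m → 0 < k → occurs Y k ≡ occurs (x ∷ xs) (suc (k ∸ 1))
    shift (suc k) k<m _ = restore k k<m
    shift′ : ∀ k → 0 < m ∸ k → occurs Y (suc k) ≡ occurs (x ∷ xs) (suc k)
    shift′ k m∸k>0 = restore k (m∸k>0⇒k<m m∸k>0)

  𝔼-stepDeck-patternStat : ∀ m q {X} → IsDeck (suc s ℕ.+ m) X →
    𝔼 (stepDeck (suc s ℕ.+ m) q X) (patternStat m q)
      ≡ ℕ→ℚ m * inv (suc s ℕ.+ m) * patternStat m q X + inv (suc s ℕ.+ m)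
  𝔼-stepDeck-patternStat m q {[]}     X↭ = contradiction (deck-length X↭) ℕₚ.0≢1+n
  𝔼-stepDeck-patternStat m q {x ∷ xs} X↭ = begin
    𝔼 (stepDeck n q (x ∷ xs)) F
      ≡⟨ 𝔼-stepDeck n q x xs F ⟩
    q * i * Σ n (λ j → F (insertAt j x xs)) + p * i * Σ n (λ j → F (insertAt j (proj₂ bottom) (proj₁ bottom)))
      ≡⟨ cong₂ (λ u v → q * i * u + p * i * v)
               (Σ-top-insertions m q x xs X↭) (Σ-bottom-insertions m q x xs X↭) ⟩
    q * i * S₁ + p * i * S₂
      ≡⟨ solve 5 (λ q p i a b → q :* i :* a :+ p :* i :* b := i :* (q :* a :+ p :* b)) refl q p i S₁ S₂ ⟩
    i * (q * S₁ + p * S₂)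
      ≡⟨ cong (i *_) (binomial-balance m q e) ⟩
    i * (ℕ→ℚ m * F (x ∷ xs) + 1ℚ)
      ≡⟨ solve 3 (λ i a f → i :* (a :* f :+ con 1ℚ) := a :* i :* f :+ i) refl i (ℕ→ℚ m) (F (x ∷ xs)) ⟩
    ℕ→ℚ m * i * F (x ∷ xs) + i ∎
    where
    n = suc s ℕ.+ m
    i = inv n
    p = 1ℚ - q
    F = patternStat m q
    bottom = removeBottom (x ∷ xs)
    e : ℕ → ℚ
    e k = occurs (x ∷ xs) (suc k)
    S₁ = Σ (suc m) (λ k → binomial m q k * (ℕ→ℚ k * e k + 1ℚ + ℕ→ℚ (m ∸ k) * e (suc k)))
    S₂ = Σ (suc m) (λ k → binomial m q k * (ℕ→ℚ k * e (k ∸ 1) + 1ℚ + ℕ→ℚ (m ∸ k) * e k))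

  patternStat-ascending : AvoidsIncreasing P → ∀ m q → patternStat m q (ascending (suc s ℕ.+ m)) ≡ 0ℚ
  patternStat-ascending avoids m q = Σ-zero (suc m) (λ k k<1+m →
    trans (cong (λ v → binomial m q k * 𝟙 v) (avoids _ (increasing k (ℕₚ.≤-pred k<1+m))))
          (*-zeroʳ (binomial m q k)))
    where
    n = suc s ℕ.+ m
    fits : ∀ {k} → k ≤ m → k ℕ.+ suc s ≤ length (ascending n)
    fits {k} k≤m = subst₂ _≤_ (ℕₚ.+-comm (suc s) k) (sym (length-ascending n)) (ℕₚ.+-monoʳ-≤ (suc s) k≤m)
    increasing : ∀ k → k ≤ m → AllPairs _<_ (window (suc s) (ascending n) (suc k))
    increasing k k≤m rewrite window-take-drop (suc s) k (ascending n) (fits k≤m) =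
      AllPairsₚ.take⁺ (suc s) (AllPairsₚ.drop⁺ k (ascending-increasing n))

  expected-patternStat : AvoidsIncreasing P → ∀ m q t →
    𝔼 (law (suc s ℕ.+ m) q t) (patternStat m q) ≡ (1ℚ - (ℕ→ℚ m * inv (suc s ℕ.+ m)) ^ t) * inv (suc s)
  expected-patternStat avoids m q =
    affine-recurrence (λ t → 𝔼 (law n q t) F) (inv-fixed-point s m) initial recurrence
    where
    n = suc s ℕ.+ m
    F = patternStat m q
    initial : 𝔼 (law n q 0) F ≡ 0ℚ
    initial = cong (λ v → 1ℚ * v + 0ℚ) (patternStat-ascending avoids m q)
    recurrence : ∀ t → 𝔼 (law n q (suc t)) F ≡ ℕ→ℚ m * inv n * 𝔼 (law n q t) F + inv n
    recurrence t = begin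
      𝔼 (step n q μ) F
        ≡⟨ 𝔼-step n q μ F ⟩
      𝔼 μ (λ d → 𝔼 (stepDeck n q d) F)
        ≡⟨ 𝔼-cong (law-decks n q t) (𝔼-stepDeck-patternStat m q) ⟩
      𝔼 μ (λ d → ℕ→ℚ m * inv n * F d + inv n)
        ≡⟨ 𝔼-affine μ (ℕ→ℚ m * inv n) (inv n) F ⟩
      ℕ→ℚ m * inv n * 𝔼 μ F + inv n * 𝔼 μ (λ _ → 1ℚ)
        ≡⟨ cong (λ v → ℕ→ℚ m * inv n * 𝔼 μ F + inv n * v) (law-mass (s ℕ.+ m) q t) ⟩
      ℕ→ℚ m * inv n * 𝔼 μ F + inv n * 1ℚ
        ≡⟨ cong (ℕ→ℚ m * inv n * 𝔼 μ F +_) (*-identityʳ (inv n)) ⟩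
      ℕ→ℚ m * inv n * 𝔼 μ F + inv n ∎
      where
      μ = law n q t

-- Descents and peaks

<ᵇ-true : ∀ {a b} → a < b → (a <ᵇ b) ≡ true
<ᵇ-true a<b = Equivalence.to T-≡ (ℕₚ.<⇒<ᵇ a<b)

<ᵇ-false : ∀ {a b} → a < b → (b <ᵇ a) ≡ false
<ᵇ-false {a} {b} a<b with b <ᵇ a in eq
... | false = refl
... | true  = contradiction (ℕₚ.<ᵇ⇒< b a (subst T (sym eq) _)) (ℕₚ.<⇒≯ a<b)

descentᵇ : List ℕ → Bool
descentᵇ (a ∷ b ∷ _) = b <ᵇ a
descentᵇ _           = false

peakᵇ : List ℕ → Bool
peakᵇ (a ∷ b ∷ c ∷ _) = (a <ᵇ b) ∧ (c <ᵇ b)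
peakᵇ _               = false

exactly-one-descent : ExactlyOneInsertion 1 descentᵇ
exactly-one-descent c (u ∷ []) refl ((c≢u ∷ []) ∷ _) with ℕₚ.<-cmp c u
... | tri< c<u _ _ rewrite <ᵇ-true c<u | <ᵇ-false c<u = refl
... | tri≈ _ c≡u _ = contradiction c≡u c≢u
... | tri> _ _ u<c rewrite <ᵇ-true u<c | <ᵇ-false u<c = refl

-- Each rewrite sequence fixes the right operands of the conjunctions first, so that no comparison
-- disappears (by false ∧ b = false) before it is rewritten.
exactly-one-peak : ExactlyOneInsertion 2 peakᵇ
exactly-one-peak c (u ∷ v ∷ []) refl ((c≢u ∷ c≢v ∷ []) ∷ (u≢v ∷ []) ∷ _)
  with ℕₚ.<-cmp c u | ℕₚ.<-cmp c v | ℕₚ.<-cmp u v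
... | tri≈ _ c≡u _ | _ | _ = contradiction c≡u c≢u
... | _ | tri≈ _ c≡v _ | _ = contradiction c≡v c≢v
... | _ | _ | tri≈ _ u≡v _ = contradiction u≡v u≢v
... | tri< c<u _ _ | tri< c<v _ _ | tri< u<v _ _
  rewrite <ᵇ-true c<v | <ᵇ-false c<v | <ᵇ-false u<v | <ᵇ-true c<u | <ᵇ-false c<u | <ᵇ-true u<v = refl
... | tri< c<u _ _ | tri< c<v _ _ | tri> _ _ v<u
  rewrite <ᵇ-true c<v | <ᵇ-false c<v | <ᵇ-true v<u | <ᵇ-true c<u | <ᵇ-false c<u | <ᵇ-false v<u = refl
... | tri< c<u _ _ | tri> _ _ v<c | tri< u<v _ _ = contradiction (ℕₚ.<-trans c<u u<v) (ℕₚ.<⇒≯ v<c)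
... | tri< c<u _ _ | tri> _ _ v<c | tri> _ _ v<u
  rewrite <ᵇ-true v<c | <ᵇ-false v<c | <ᵇ-true v<u | <ᵇ-true c<u | <ᵇ-false c<u | <ᵇ-false v<u = refl
... | tri> _ _ u<c | tri< c<v _ _ | tri< u<v _ _
  rewrite <ᵇ-true c<v | <ᵇ-false c<v | <ᵇ-false u<v | <ᵇ-true u<c | <ᵇ-false u<c | <ᵇ-true u<v = refl
... | tri> _ _ u<c | tri< c<v _ _ | tri> _ _ v<u = contradiction (ℕₚ.<-trans v<u u<c) (ℕₚ.<⇒≯ c<v)
... | tri> _ _ u<c | tri> _ _ v<c | tri< u<v _ _
  rewrite <ᵇ-true v<c | <ᵇ-false v<c | <ᵇ-false u<v | <ᵇ-true u<c | <ᵇ-false u<c | <ᵇ-true u<v = refl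
... | tri> _ _ u<c | tri> _ _ v<c | tri> _ _ v<u
  rewrite <ᵇ-true v<c | <ᵇ-false v<c | <ᵇ-true v<u | <ᵇ-true u<c | <ᵇ-false u<c | <ᵇ-false v<u = refl

descent-avoids-increasing : AvoidsIncreasing descentᵇ
descent-avoids-increasing []          _               = refl
descent-avoids-increasing (a ∷ [])    _               = refl
descent-avoids-increasing (a ∷ b ∷ _) ((a<b ∷ _) ∷ _) = <ᵇ-false a<b

peak-avoids-increasing : AvoidsIncreasing peakᵇ
peak-avoids-increasing []              _                   = refl
peak-avoids-increasing (a ∷ [])        _                   = refl
peak-avoids-increasing (a ∷ b ∷ [])    _                   = refl
peak-avoids-increasing (a ∷ b ∷ c ∷ _) (_ ∷ (b<c ∷ _) ∷ _) rewrite <ᵇ-false b<c = ∧-zeroʳ (a <ᵇ b)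

module Descents = Pattern 1 descentᵇ exactly-one-descent
module Peaks = Pattern 2 peakᵇ exactly-one-peak

sumℚ-filter : ∀ (b : ℕ → Bool) (g : ℕ → ℚ) xs →
  sumℚ (map g (filter (λ i → T? (b i)) xs)) ≡ sumℚ (map (λ i → g i * 𝟙 (b i)) xs)
sumℚ-filter b g []       = refl
sumℚ-filter b g (x ∷ xs) with b x
... | true  = cong₂ _+_ (sym (*-identityʳ (g x))) (sumℚ-filter b g xs)
... | false = trans (sumℚ-filter b g xs) (sym (trans (cong (_+ _) (*-zeroʳ (g x))) (+-identityˡ _)))

sumℚ-filter-from1 : ∀ (b : ℕ → Bool) (g : ℕ → ℚ) K →
  sumℚ (map g (filter (λ i → T? (b i)) (from1 K))) ≡ Σ K (λ k → g (suc k) * 𝟙 (b (suc k)))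
sumℚ-filter-from1 b g K = begin
  sumℚ (map g (filter (λ i → T? (b i)) (from1 K)))   ≡⟨ sumℚ-filter b g (from1 K) ⟩
  sumℚ (map h (map suc (upTo K)))                    ≡⟨ cong sumℚ (sym (map-∘ (upTo K))) ⟩
  sumℚ (map (h ∘ suc) (upTo K))                      ≡⟨ sumℚ-map-applyUpTo (h ∘ suc) id K ⟩
  Σ K (h ∘ suc)                                      ∎
  where
  h : ℕ → ℚ
  h i = g i * 𝟙 (b i)

desStat≡patternStat : ∀ m q X → desStat (suc (suc m)) q X ≡ Descents.patternStat m q X
desStat≡patternStat m q X = sumℚ-filter-from1
  (λ i → card X (suc i) <ᵇ card X i)
  (λ i → ℕ→ℚ (m C (i ∸ 1)) * q ^ (i ∸ 1) * (1ℚ - q) ^ (suc m ∸ i))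
  (suc m)

peakStat≡patternStat : ∀ m q X → peakStat (suc (suc (suc m))) q X ≡ Peaks.patternStat m q X
peakStat≡patternStat m q X = sumℚ-filter-from1
  (λ i → (card X i <ᵇ card X (suc i)) ∧ (card X (suc (suc i)) <ᵇ card X (suc i)))
  (λ i → ℕ→ℚ (m C (i ∸ 1)) * q ^ (i ∸ 1) * (1ℚ - q) ^ (suc m ∸ i))
  (suc m)

expected-descents : ∀ m q t → 𝔼 (law (suc (suc m)) q t) (desStat (suc (suc m)) q)
  ≡ (1ℚ - (ℕ→ℚ m * inv (suc (suc m))) ^ t) * half
expected-descents m q t = trans (𝔼-cong (law-decks _ q t) (λ {X} _ → desStat≡patternStat m q X))
                                (Descents.expected-patternStat descent-avoids-increasing m q t)

expected-peaks : ∀ m q t → 𝔼 (law (suc (suc (suc m))) q t) (peakStat (suc (suc (suc m))) q)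
  ≡ (1ℚ - (ℕ→ℚ m * inv (suc (suc (suc m)))) ^ t) * third
expected-peaks m q t = trans (𝔼-cong (law-decks _ q t) (λ {X} _ → peakStat≡patternStat m q X))
                             (Peaks.expected-patternStat peak-avoids-increasing m q t)

-- The identities are polynomial in q.
proposition5p2 : (n : ℕ) → 2 ≤ n → (q : ℚ) → 0ℚ ≤ℚ q → q ≤ℚ 1ℚ → (t : ℕ) →
    (𝔼 (law n q t) (desStat n q) ≡ (1ℚ - (ℕ→ℚ (n Data.Nat.∸ 2) * inv n) ^ t) * half)
    × (3 ≤ n → 𝔼 (law n q t) (peakStat n q) ≡ (1ℚ - (ℕ→ℚ (n Data.Nat.∸ 3) * inv n) ^ t) * third)
proposition5p2 (suc (suc m)) (s≤s (s≤s _)) q _ _ t = expected-descents m q t , peaks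
  where
  peaks : 3 ≤ suc (suc m) → _
  peaks (s≤s (s≤s (s≤s {n = m′} _))) = expected-peaks m′ q t
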